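{- Let $\lambda=(m,n)$ be a triangular $2$-partition with top-down tableau $\theta$. For an integer $s$ with $0\le s\le m+n$, let $E(s)$ be the set of subpartitions $\mu$ of $\lambda$ with $\mathrm{sim}_\theta(\mu)=s$. Then: (1) If $s\le m-n$, then $E(s)=\{(s,k):0\le k\le\min(s,n)\}$, so $|E(s)|=\min(s,n)+1$; all its elements are on the right side, except $(m-n)=(m-n,0)\in E(m-n)$, which is in the center. (2) If $s>m-n$ and $s\equiv m+n \pmod 2$, then there is an integer $i$ with $0\le i<n$ and $s=m+n-2i$, and $E(s)=\{(m-i,n-j):0\le j\le i\}$, so $|E(s)|=i+1$; the subpartition $(m-i,n-i)$ is in the center and the others are on the right side. (3) If $s>m-n$ and $s\not\equiv m+n\pmod 2$, then there is an integer $j$ with $1\le j\le n$ and $s=m+n-2j+1$, and $E(s)=\{(m-i,n-j):0\le i<j\}$, so $|E(s)|=j$; all its elements are on the left side.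
   Context: Partitions are drawn in French convention: cell $(\ell,c)$ ($\ell\ge0$ row from bottom, $c\ge0$ column). A $2$-partition $(m,n)$ has $m\ge n\ge0$; it is triangular if there exist positive reals $r,s$ with $\lambda_j=\lfloor r-jr/s\rfloor$ for $1\le j\le s$ and $\lambda_j=0$ for $j>s$. The top-down tableau of a partition of size $N$ labels with $N$ the last cell of the top row, $N-1$ the last cell of the row below, etc., one cell per nonempty row down to the bottom, then repeats on the remaining cells with the next smaller labels (for $(m,n)$ the upper row gets $m-n+2,m-n+4,\dots,m+n$). For a standard tableau $\theta$ and subpartition $\mu$, a cell $d$ is a $\theta$-deficit cell if there exist $c_1=(i_1,j_1)\in\mu$, $c_2=(i_2,j_2)\in\lambda\setminus\mu$ with $\theta(c_1)>\theta(c_2)$ and $d=(\min(i_1,i_2),\min(j_1,j_2))$; $\mathrm{sim}_\theta(\mu)$ is the number of cells of $\mu$ that are not $\theta$-deficit cells. A subpartition $(m-i,n-j)$ is on the left side if $i<j$, in the center if $i=j$, on the right side if $i>j$.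
   Formalization: The parameters r and s in the definition of a triangular 2-partition range only over the positive rationals instead of the positive reals. -}

module Defs where

open import Data.Nat using (ℕ; zero; suc; _+_; _*_; _∸_; _≤_; _<_; _⊓_; _≟_)
open import Data.Nat.Properties using (_<?_)
open import Data.Integer as ℤ using (ℤ; +_)
open import Data.Rational as ℚ using (ℚ; 0ℚ; floor; _÷_)
open import Data.Rational.Properties using (pos⇒nonZero)
open import Data.Product using (Σ; ∃; _×_; _,_; proj₁; proj₂)
open import Data.Product.Properties using (≡-dec)
open import Data.List using (List; []; _∷_; map; _++_; upTo; filter; length; concatMap)
open import Data.List.Relation.Unary.Any using (Any; any?)
open import Data.Bool using (if_then_else_)
open import Relation.Nullary using (¬_; Dec; yes; no; ¬?; _×-dec_)
open import Relation.Binary.PropositionalEquality using (_≡_)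
open import Relation.Binary using (DecidableEquality)

part : ℕ → ℕ → ℕ → ℕ
part m n 1 = m
part m n 2 = n
part m n _ = 0

ℕ→ℚ : ℕ → ℚ
ℕ→ℚ j = (+ j) ℚ./ 1

divPos : (p q : ℚ) → 0ℚ ℚ.< q → ℚ
divPos p q q>0 = _÷_ p q {{pos⇒nonZero q {{ℚ.positive q>0}}}}

-- Triangular (paper: positive reals r, s; here positive rationals)
-- λ_j = ⌊ r - j r / s ⌋ for 1 ≤ j ≤ s, and λ_j = 0 for j > s.
Triangular : ℕ → ℕ → Set
Triangular m n =
  n ≤ m ×
  Σ ℚ λ r → Σ ℚ λ s → Σ (0ℚ ℚ.< r) λ r>0 → Σ (0ℚ ℚ.< s) λ s>0 →
    ∀ (j : ℕ) → 1 ≤ j →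
      (ℕ→ℚ j ℚ.≤ s → floor (r ℚ.- divPos (ℕ→ℚ j ℚ.* r) s s>0) ≡ + part m n j) ×
      (s ℚ.< ℕ→ℚ j → part m n j ≡ 0)

-- Cells (ℓ , c): ℓ = row from the bottom, c = column (French convention).

Cell : Set
Cell = ℕ × ℕ

_≟ᶜ_ : DecidableEquality Cell
_≟ᶜ_ = ≡-dec _≟_ _≟_

open import Data.List.Membership.DecPropositional _≟ᶜ_ using (_∈_; _∉_; _∈?_) public

cells : ℕ × ℕ → List Cell
cells (a , b) = map (λ c → (0 , c)) (upTo a) ++ map (λ c → (1 , c)) (upTo b)

-- Top-down tableau of (m , n), m ≥ n: label N = m+n on the last cell of the
-- top row, N-1 on the last cell of the row below, then recurse on the
-- remaining shape (m-1 , n-1); when only the bottom row is left (n = 0) its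
-- cells get labels 1 , … , m from left to right.
topDown : ℕ → ℕ → Cell → ℕ
topDown m       zero    (0 , c) = suc c
topDown m       zero    _       = 0
topDown zero    (suc n) _       = 0
topDown (suc m) (suc n) (0 , c) with c ≟ m
... | yes _ = suc (m + n)
... | no  _ = topDown m n (0 , c)
topDown (suc m) (suc n) (1 , c) with c ≟ n
... | yes _ = suc (suc (m + n))
... | no  _ = topDown m n (1 , c)
topDown (suc m) (suc n) _       = 0

meet : Cell → Cell → Cell
meet (i₁ , j₁) (i₂ , j₂) = (i₁ ⊓ i₂ , j₁ ⊓ j₂)

Deficit : ℕ × ℕ → ℕ × ℕ → Cell → Set
Deficit (m , n) μ d =
  Any (λ c₁ → Any (λ c₂ → c₂ ∉ cells μ × topDown m n c₂ < topDown m n c₁ × d ≡ meet c₁ c₂)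
                  (cells (m , n)))
      (cells μ)

deficit? : ∀ lam μ d → Dec (Deficit lam μ d)
deficit? (m , n) μ d =
  any? (λ c₁ → any? (λ c₂ → ¬? (c₂ ∈? cells μ) ×-dec (topDown m n c₂ <? topDown m n c₁)
                              ×-dec (d ≟ᶜ meet c₁ c₂))
                    (cells (m , n)))
       (cells μ)

sim : ℕ × ℕ → ℕ × ℕ → ℕ
sim lam μ = length (filter (λ d → ¬? (deficit? lam μ d)) (cells μ))

subpartitions : ℕ × ℕ → List (ℕ × ℕ)
subpartitions (m , n) =
  filter (λ { (a , b) → b Data.Nat.≤? a })
    (concatMap (λ a → map (λ b → (a , b)) (upTo (suc n))) (upTo (suc m)))

E : ℕ × ℕ → ℕ → List (ℕ × ℕ)
E lam s = filter (λ μ → sim lam μ ≟ s) (subpartitions lam)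

LeftSide Center RightSide : ℕ × ℕ → ℕ × ℕ → Set
LeftSide  (m , n) (a , b) = m ∸ a < n ∸ b
Center    (m , n) (a , b) = m ∸ a ≡ n ∸ b
RightSide (m , n) (a , b) = n ∸ b < m ∸ a

-- Write m = n + t. The top-down tableau of (n + t , n) labels the first t bottom cells 1, …, t and
-- then alternates between the rows column by column: bottom cell c gets c + 1 + (c ∸ t) and top
-- cell c gets t + 2c + 2. Comparing labels, the deficit cells of a subpartition μ = (a , b) are,
-- with u = a ∸ t, the bottom cells in the columns [u, b) when u ≤ b and in [b, u - 1) when b < u.
-- Counting the remaining cells gives sim(μ) = a + u in the first case and t + 2b + 1 in the
-- second, and solving sim(μ) = s yields (1) for s ≤ t; above t the first case produces exactly
-- the values of the parity of m + n, giving (2), and the second case the others, giving (3).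
-- Triangularity enters only through 2n ≤ m + 1, which makes (m - i , n - j) a partition in (2):
-- with h(j) = r - jr/s one has λ_j = ⌊h(j)⌋, so 2n ≤ 2h(2) = h(1) + h(3) < (m + 1) + 1.

module Submission where

open import Defs
open import Data.Nat using (ℕ; _+_; _*_; _∸_; _≤_; _<_; _⊓_; _%_)
open import Data.Product using (Σ; ∃; ∃-syntax; _×_; _,_)
open import Data.List using (length)
open import Function.Bundles using (_⇔_)
open import Relation.Nullary using (¬_)
open import Relation.Binary.PropositionalEquality using (_≡_; _≢_)

open import Data.Nat using (zero; suc; z≤n; s≤s; s≤s⁻¹; z<s; _≟_; _≤?_; _<?_; >-nonZero)
open import Data.Nat.Properties
open import Data.Nat.Coprimality using (1-coprimeTo) renaming (sym to coprime-sym)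
open import Data.Nat.DivMod using ([m+kn]%n≡m%n)
open import Data.Nat.Solver using (module +-*-Solver)
import Data.Integer as ℤ
import Data.Integer.Properties as ℤ
import Data.Integer.DivMod as ℤ
open import Data.Rational as ℚ using (ℚ; mkℚ; 0ℚ; floor; *≤*; *<*; 1/_)
import Data.Rational.Properties as ℚ
open import Data.Rational.Solver using () renaming (module +-*-Solver to ℚ-Solver)
open import Data.Product using (proj₁; proj₂)
open import Data.Sum using (_⊎_; inj₁; inj₂)
open import Data.List using (List; []; _∷_; [_]; map; _++_; upTo; applyUpTo; filter; concatMap; cartesianProduct)
open import Data.List.Properties
  using (filter-accept; filter-reject; filter-++; filter-all; length-++; length-map; length-upTo; upTo-∷ʳ; length-applyUpTo)
open import Data.List.Relation.Unary.All as All using (All; []; _∷_)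
open import Data.List.Membership.Propositional as Mem using (find; lose)
import Data.List.Membership.Propositional.Properties as ∈
open import Data.List.Membership.Propositional.Properties.WithK using (unique∧set⇒bag)
open import Data.List.Relation.Binary.BagAndSetEquality using (∼bag⇒↭)
open import Data.List.Relation.Binary.Permutation.Propositional.Properties using (↭-length)
open import Data.List.Relation.Unary.Unique.Propositional using (Unique)
import Data.List.Relation.Unary.Unique.Propositional.Properties as Unique
open import Function using (_∘_)
open import Function.Bundles using (mk⇔; Equivalence)
open import Relation.Binary.PropositionalEquality using (refl; sym; trans; cong; cong₂; subst; subst₂; module ≡-Reasoning)
open import Relation.Nullary using (yes; no; contradiction)
open import Relation.Nullary.Decidable using (_×-dec_; ¬?)
open import Relation.Unary using (Pred; Decidable)
open import Level using (0ℓ)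

length-filter-map : ∀ {A B : Set} {P : Pred B 0ℓ} {Q : Pred A 0ℓ} (P? : Decidable P) (Q? : Decidable Q) (f : A → B) →
                    ∀ {xs} → All (λ x → P (f x) ⇔ Q x) xs → length (filter P? (map f xs)) ≡ length (filter Q? xs)
length-filter-map P? Q? f [] = refl
length-filter-map P? Q? f {x ∷ _} (Pfx⇔Qx ∷ Pf⇔Q) with P? (f x) | Q? x
... | yes _   | yes _   = cong suc (length-filter-map P? Q? f Pf⇔Q)
... | yes Pfx | no ¬Qx  = contradiction (Equivalence.to Pfx⇔Qx Pfx) ¬Qx
... | no ¬Pfx | yes Qx  = contradiction (Equivalence.from Pfx⇔Qx Qx) ¬Pfx
... | no _    | no _    = length-filter-map P? Q? f Pf⇔Q

module _ {P : Pred ℕ 0ℓ} (P? : Decidable P) {k : ℕ} where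

  private
    length-filter-upTo-suc : length (filter P? (upTo (suc k))) ≡ length (filter P? (upTo k)) + length (filter P? [ k ])
    length-filter-upTo-suc = begin
      length (filter P? (upTo (suc k)))                         ≡⟨ cong (length ∘ filter P?) (upTo-∷ʳ k) ⟨
      length (filter P? (upTo k ++ [ k ]))                      ≡⟨ cong length (filter-++ P? (upTo k) [ k ]) ⟩
      length (filter P? (upTo k) ++ filter P? [ k ])            ≡⟨ length-++ (filter P? (upTo k)) ⟩
      length (filter P? (upTo k)) + length (filter P? [ k ])    ∎
      where open ≡-Reasoning

  count-upTo-accept : P k → length (filter P? (upTo (suc k))) ≡ suc (length (filter P? (upTo k)))
  count-upTo-accept Pk = trans length-filter-upTo-suc
    (trans (cong (λ l → length (filter P? (upTo k)) + length l) (filter-accept P? Pk)) (+-comm _ 1))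

  count-upTo-reject : ¬ P k → length (filter P? (upTo (suc k))) ≡ length (filter P? (upTo k))
  count-upTo-reject ¬Pk = trans length-filter-upTo-suc
    (trans (cong (λ l → length (filter P? (upTo k)) + length l) (filter-reject P? ¬Pk)) (+-identityʳ _))

Inside : ℕ → ℕ → ℕ → Set
Inside p q x = p ≤ x × x < q

outside? : ∀ p q → Decidable (¬_ ∘ Inside p q)
outside? p q x = ¬? ((p ≤? x) ×-dec (x <? q))

count-outside : ∀ {p q} → p ≤ q → ∀ k → length (filter (outside? p q) (upTo k)) ≡ p ⊓ k + (k ∸ q)
count-outside {p} {q} p≤q zero = sym (cong₂ _+_ (⊓-zeroʳ p) (0∸n≡0 q))
count-outside {p} {q} p≤q (suc k) with k <? p | q ≤? k
... | yes k<p | _ = begin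
  length (filter (outside? p q) (upTo (suc k))) ≡⟨ count-upTo-accept (outside? p q) (λ (p≤k , _) → <⇒≱ k<p p≤k) ⟩
  suc (length (filter (outside? p q) (upTo k))) ≡⟨ cong suc (count-outside p≤q k) ⟩
  suc (p ⊓ k + (k ∸ q))                         ≡⟨ cong₂ (λ x y → suc (x + y)) (m≥n⇒m⊓n≡n (<⇒≤ k<p)) (m≤n⇒m∸n≡0 (<⇒≤ k<q)) ⟩
  suc k + 0                                     ≡⟨ cong₂ _+_ (m≥n⇒m⊓n≡n k<p) (m≤n⇒m∸n≡0 k<q) ⟨
  p ⊓ suc k + (suc k ∸ q)                       ∎
  where open ≡-Reasoning
        k<q = <-≤-trans k<p p≤q
... | no k≮p | yes q≤k = begin
  length (filter (outside? p q) (upTo (suc k))) ≡⟨ count-upTo-accept (outside? p q) (λ (_ , k<q) → <⇒≱ k<q q≤k) ⟩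
  suc (length (filter (outside? p q) (upTo k))) ≡⟨ cong suc (count-outside p≤q k) ⟩
  suc (p ⊓ k + (k ∸ q))                         ≡⟨ +-suc (p ⊓ k) (k ∸ q) ⟨
  p ⊓ k + suc (k ∸ q)                           ≡⟨ cong₂ _+_ (⊓-stable k≮p) (+-∸-assoc 1 q≤k) ⟨
  p ⊓ suc k + (suc k ∸ q)                       ∎
  where open ≡-Reasoning
        ⊓-stable : ¬ k < p → p ⊓ suc k ≡ p ⊓ k
        ⊓-stable k≮p = trans (m≤n⇒m⊓n≡m (m≤n⇒m≤1+n (≮⇒≥ k≮p))) (sym (m≤n⇒m⊓n≡m (≮⇒≥ k≮p)))
... | no k≮p | no q≰k = begin
  length (filter (outside? p q) (upTo (suc k))) ≡⟨ count-upTo-reject (outside? p q) (λ ¬inside → ¬inside (≮⇒≥ k≮p , ≰⇒> q≰k)) ⟩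
  length (filter (outside? p q) (upTo k))       ≡⟨ count-outside p≤q k ⟩
  p ⊓ k + (k ∸ q)                               ≡⟨ cong₂ _+_ (m≤n⇒m⊓n≡m (≮⇒≥ k≮p)) (m≤n⇒m∸n≡0 (<⇒≤ (≰⇒> q≰k))) ⟩
  p + 0                                         ≡⟨ cong₂ _+_ (m≤n⇒m⊓n≡m (m≤n⇒m≤1+n (≮⇒≥ k≮p))) (m≤n⇒m∸n≡0 (≰⇒> q≰k)) ⟨
  p ⊓ suc k + (suc k ∸ q)                       ∎
  where open ≡-Reasoning

length-enumeration : ∀ {A : Set} {xs : List A} (f : ℕ → A) {k} → Unique xs →
                     (∀ {z} → z Mem.∈ xs → ∃[ i ] (i < k × z ≡ f i)) → (∀ {i} → i < k → f i Mem.∈ xs) →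
                     (∀ {i j} → i < j → j < k → f i ≢ f j) → length xs ≡ k
length-enumeration {xs = xs} f {k} xs-unique enumerated listed f-injective =
  trans (↭-length (∼bag⇒↭ (unique∧set⇒bag xs-unique (Unique.applyUpTo⁺₁ f k f-injective) same-elements)))
        (length-applyUpTo f k)
  where
  same-elements : ∀ {z} → z Mem.∈ xs ⇔ z Mem.∈ applyUpTo f k
  same-elements = mk⇔
    (λ z∈xs → let i , i<k , z≡fi = enumerated z∈xs in subst (Mem._∈ applyUpTo f k) (sym z≡fi) (∈.∈-applyUpTo⁺ f i<k))
    (λ z∈fs → let i , i<k , z≡fi = ∈.∈-applyUpTo⁻ f z∈fs in subst (Mem._∈ xs) (sym z≡fi) (listed i<k))

-- Parity and doubling

even-or-odd : ∀ d → (∃[ i ] d ≡ 2 * i) ⊎ (∃[ i ] d ≡ suc (2 * i))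
even-or-odd zero = inj₁ (0 , refl)
even-or-odd (suc d) with even-or-odd d
... | inj₁ (i , d≡2i)   = inj₂ (i , cong suc d≡2i)
... | inj₂ (i , d≡1+2i) = inj₁ (suc i , trans (cong suc d≡1+2i) (sym (*-suc 2 i)))

[m+2i]%2≡m%2 : ∀ m i → (m + 2 * i) % 2 ≡ m % 2
[m+2i]%2≡m%2 m i = trans (cong (λ k → (m + k) % 2) (*-comm 2 i)) ([m+kn]%n≡m%n m i 2)

[1+m]%2≢m%2 : ∀ m → suc m % 2 ≢ m % 2
[1+m]%2≢m%2 zero          ()
[1+m]%2≢m%2 (suc zero)    ()
[1+m]%2≢m%2 (suc (suc m)) = [1+m]%2≢m%2 m

same-parity⇒even-gap : ∀ {s N} → s ≤ N → s % 2 ≡ N % 2 → ∃[ i ] s + 2 * i ≡ N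
same-parity⇒even-gap {s} {N} s≤N s≡N with even-or-odd (N ∸ s)
... | inj₁ (i , N∸s≡2i) = i , trans (cong (s +_) (sym N∸s≡2i)) (m+[n∸m]≡n s≤N)
... | inj₂ (i , N∸s≡1+2i) =
  contradiction (trans (sym ([m+2i]%2≡m%2 (suc s) i)) (trans (cong (_% 2) 1+s+2i≡N) (sym s≡N))) ([1+m]%2≢m%2 s)
  where
  1+s+2i≡N : suc s + 2 * i ≡ N
  1+s+2i≡N = trans (sym (+-suc s (2 * i))) (trans (cong (s +_) (sym N∸s≡1+2i)) (m+[n∸m]≡n s≤N))

different-parity⇒odd-gap : ∀ {s N} → s ≤ N → s % 2 ≢ N % 2 → ∃[ j ] s + 2 * j ≡ N + 1
different-parity⇒odd-gap {s} {N} s≤N s≢N with even-or-odd (N ∸ s)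
... | inj₁ (i , N∸s≡2i) = contradiction (sym (trans (cong (_% 2) (sym s+2i≡N)) ([m+2i]%2≡m%2 s i))) s≢N
  where
  s+2i≡N : s + 2 * i ≡ N
  s+2i≡N = trans (cong (s +_) (sym N∸s≡2i)) (m+[n∸m]≡n s≤N)
... | inj₂ (i , N∸s≡1+2i) = suc i , (begin
  s + 2 * suc i         ≡⟨ cong (s +_) (*-suc 2 i) ⟩
  s + suc (suc (2 * i)) ≡⟨ +-suc s (suc (2 * i)) ⟩
  suc (s + suc (2 * i)) ≡⟨ cong (λ k → suc (s + k)) N∸s≡1+2i ⟨
  suc (s + (N ∸ s))     ≡⟨ cong suc (m+[n∸m]≡n s≤N) ⟩
  suc N                 ≡⟨ +-comm 1 N ⟩
  N + 1                 ∎)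
  where open ≡-Reasoning

n<m+[m∸n]⇒n≤m : ∀ {m n} → n < m + (m ∸ n) → n ≤ m
n<m+[m∸n]⇒n≤m {m} {n} n<m+[m∸n] with n ≤? m
... | yes n≤m = n≤m
... | no  n≰m =
  contradiction (subst (n <_) (trans (cong (m +_) (m≤n⇒m∸n≡0 m≤n)) (+-identityʳ m)) n<m+[m∸n]) (≤⇒≯ m≤n)
  where m≤n = <⇒≤ (≰⇒> n≰m)

m+[m∸n]≡n+2[m∸n] : ∀ {m n} → n ≤ m → m + (m ∸ n) ≡ n + 2 * (m ∸ n)
m+[m∸n]≡n+2[m∸n] {m} {n} n≤m = begin
  m + (m ∸ n)                 ≡⟨ cong (_+ (m ∸ n)) (m+[n∸m]≡n n≤m) ⟨
  n + (m ∸ n) + (m ∸ n)       ≡⟨ solve 2 (λ n d → n :+ d :+ d := n :+ con 2 :* d) refl n (m ∸ n) ⟩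
  n + 2 * (m ∸ n)             ∎
  where open ≡-Reasoning
        open +-*-Solver

t+2u≡t+2c⇒u≡c : ∀ t {u c} → t + 2 * u ≡ t + 2 * c → u ≡ c
t+2u≡t+2c⇒u≡c t {u} {c} eq = *-cancelˡ-≡ u c 2 (+-cancelˡ-≡ t (2 * u) (2 * c) eq)

t+2u≢1+t+2c : ∀ t u c → t + 2 * u ≢ suc (t + 2 * c)
t+2u≢1+t+2c t u c eq = even≢odd u c (+-cancelˡ-≡ t (2 * u) (suc (2 * c)) (trans eq (sym (+-suc t (2 * c)))))

-- Triangularity

-- ℕ→ℚ k = + k / 1 normalises through gcd k 1, which does not reduce for a variable k, so the
-- floor bounds are stated for its normal form natℚ k.
natℚ : ℕ → ℚ
natℚ k = mkℚ (ℤ.+ k) 0 (coprime-sym (1-coprimeTo k))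

natℚ-+ : ∀ a b → natℚ a ℚ.+ natℚ b ≡ natℚ (a + b)
natℚ-+ a b = trans (cong₂ (λ x y → (x ℤ.+ y) ℚ./ 1) (ℤ.*-identityʳ (ℤ.+ a)) (ℤ.*-identityʳ (ℤ.+ b)))
                   (ℚ.normalize-coprime (coprime-sym (1-coprimeTo (a + b))))

natℚ-<⁻¹ : ∀ {a b} → natℚ a ℚ.< natℚ b → a < b
natℚ-<⁻¹ {a} {b} (*<* a<b) = ℤ.drop‿+<+ (subst₂ ℤ._<_ (ℤ.*-identityʳ (ℤ.+ a)) (ℤ.*-identityʳ (ℤ.+ b)) a<b)

floor≡⇒bounds : ∀ q k → floor q ≡ ℤ.+ k → natℚ k ℚ.≤ q × q ℚ.< natℚ (suc k)
floor≡⇒bounds (mkℚ a d _) k ⌊q⌋≡k = *≤* lower , *<* upper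
  where
  lower : ℤ.+ k ℤ.* ℤ.+ suc d ℤ.≤ a ℤ.* ℤ.+ 1
  lower = subst₂ ℤ._≤_ (cong (ℤ._* ℤ.+ suc d) ⌊q⌋≡k) (sym (ℤ.*-identityʳ a)) (ℤ.[n/d]*d≤n a (ℤ.+ suc d))
  upper : a ℤ.* ℤ.+ 1 ℤ.< ℤ.+ suc k ℤ.* ℤ.+ suc d
  upper = subst₂ ℤ._<_ (sym (ℤ.*-identityʳ a))
            (cong (λ z → ℤ.suc z ℤ.* ℤ.+ suc d) (trans (sym (ℤ.div-pos-is-/ℕ a (suc d))) ⌊q⌋≡k))
            (ℤ.n<s[n/ℕd]*d a (suc d))

module Hypotenuse (r s : ℚ) .{{_ : ℚ.Positive r}} .{{_ : ℚ.Positive s}} where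

  private instance
    s≢0 : ℚ.NonZero s
    s≢0 = ℚ.pos⇒nonZero s

  hypotenuse : ℕ → ℚ
  hypotenuse j = r ℚ.- ℕ→ℚ j ℚ.* r ℚ.* 1/ s

  hypotenuse-affine : hypotenuse 2 ℚ.+ hypotenuse 2 ≡ hypotenuse 1 ℚ.+ hypotenuse 3
  hypotenuse-affine = solve 2 (λ r w → (r :- con (ℕ→ℚ 2) :* r :* w) :+ (r :- con (ℕ→ℚ 2) :* r :* w)
                            := (r :- con (ℕ→ℚ 1) :* r :* w) :+ (r :- con (ℕ→ℚ 3) :* r :* w)) refl r (1/ s)
    where open ℚ-Solver

  hypotenuse<0 : ∀ j → s ℚ.< ℕ→ℚ j → hypotenuse j ℚ.< 0ℚ
  hypotenuse<0 j s<j = subst (hypotenuse j ℚ.<_) (ℚ.+-inverseʳ jr/s) (ℚ.+-monoˡ-< (ℚ.- jr/s) r<jr/s)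
    where
    jr/s = ℕ→ℚ j ℚ.* r ℚ.* 1/ s
    jr/s*s≡r*j : jr/s ℚ.* s ≡ r ℚ.* ℕ→ℚ j
    jr/s*s≡r*j = trans (ℚ.*-assoc (ℕ→ℚ j ℚ.* r) (1/ s) s)
                   (trans (cong (ℕ→ℚ j ℚ.* r ℚ.*_) (ℚ.*-inverseˡ s))
                     (trans (ℚ.*-identityʳ _) (ℚ.*-comm (ℕ→ℚ j) r)))
    r<jr/s : r ℚ.< jr/s
    r<jr/s = ℚ.*-cancelʳ-<-nonNeg s {{ℚ.pos⇒nonNeg s}}
               (subst (r ℚ.* s ℚ.<_) (sym jr/s*s≡r*j) (ℚ.*-monoʳ-<-pos r s<j))

triangular⇒n+n≤1+m : ∀ {m n} → Triangular m n → n + n ≤ suc m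
triangular⇒n+n≤1+m {m} {zero} _ = z≤n
triangular⇒n+n≤1+m {m} {n@(suc _)} (_ , r , s , r>0 , s>0 , floor≡part) =
  <⇒≤pred (subst (n + n <_) (+-comm (suc m) 1) (natℚ-<⁻¹ (begin-strict
    natℚ (n + n)                  ≡⟨ sym (natℚ-+ n n) ⟩
    natℚ n ℚ.+ natℚ n             ≤⟨ ℚ.+-mono-≤ n≤h₂ n≤h₂ ⟩
    hypotenuse 2 ℚ.+ hypotenuse 2 ≡⟨ hypotenuse-affine ⟩
    hypotenuse 1 ℚ.+ hypotenuse 3 <⟨ ℚ.+-mono-< h₁<1+m h₃<1 ⟩
    natℚ (suc m) ℚ.+ natℚ 1       ≡⟨ natℚ-+ (suc m) 1 ⟩
    natℚ (suc m + 1)              ∎)))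
  where
  open ℚ.≤-Reasoning
  instance
    r⁺ : ℚ.Positive r
    r⁺ = ℚ.positive r>0
    s⁺ : ℚ.Positive s
    s⁺ = ℚ.positive s>0
  open Hypotenuse r s
  2≤s : ℕ→ℚ 2 ℚ.≤ s
  2≤s = ℚ.≮⇒≥ (λ s<2 → 1+n≢0 (proj₂ (floor≡part 2 (s≤s z≤n)) s<2))
  n≤h₂ : natℚ n ℚ.≤ hypotenuse 2
  n≤h₂ = proj₁ (floor≡⇒bounds _ n (proj₁ (floor≡part 2 (s≤s z≤n)) 2≤s))
  h₁<1+m : hypotenuse 1 ℚ.< natℚ (suc m)
  h₁<1+m = proj₂ (floor≡⇒bounds _ m (proj₁ (floor≡part 1 ≤-refl) (ℚ.≤-trans (*≤* (ℤ.+≤+ (s≤s z≤n))) 2≤s)))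
  h₃<1 : hypotenuse 3 ℚ.< natℚ 1
  h₃<1 with ℕ→ℚ 3 ℚ.≤? s
  ... | yes 3≤s = proj₂ (floor≡⇒bounds _ 0 (proj₁ (floor≡part 3 (s≤s z≤n)) 3≤s))
  ... | no 3≰s = ℚ.<-trans (hypotenuse<0 3 (ℚ.≰⇒> 3≰s)) (*<* (ℤ.+<+ (s≤s z≤n)))

-- The top-down tableau of (n + t , n)

bottomLabel topLabel : ℕ → ℕ → ℕ
bottomLabel t c = suc (c + (c ∸ t))
topLabel    t c = suc (suc (t + (c + c)))

topDown-bottom : ∀ n t c → c < n + t → topDown (n + t) n (0 , c) ≡ bottomLabel t c
topDown-bottom zero    t c c<t = cong suc (sym (trans (cong (c +_) (m≤n⇒m∸n≡0 (<⇒≤ c<t))) (+-identityʳ c)))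
topDown-bottom (suc n) t c c<1+n+t with c ≟ n + t
... | yes refl = cong (λ k → suc (n + t + k)) (sym (m+n∸n≡m n t))
... | no  c≢n+t = topDown-bottom n t c (≤∧≢⇒< (s≤s⁻¹ c<1+n+t) c≢n+t)

topDown-top : ∀ n t c → c < n → topDown (n + t) n (1 , c) ≡ topLabel t c
topDown-top (suc n) t c c<1+n with c ≟ n
... | yes refl = cong (suc ∘ suc) (solve 2 (λ n t → n :+ t :+ n := t :+ (n :+ n)) refl n t)
  where open +-*-Solver
... | no  c≢n  = topDown-top n t c (≤∧≢⇒< (s≤s⁻¹ c<1+n) c≢n)

topDown-bottom-mono-≤ : ∀ n t {x y} → x ≤ y → y < n + t → topDown (n + t) n (0 , x) ≤ topDown (n + t) n (0 , y)
topDown-bottom-mono-≤ n t {x} {y} x≤y y<n+t =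
  subst₂ _≤_ (sym (topDown-bottom n t x (≤-<-trans x≤y y<n+t))) (sym (topDown-bottom n t y y<n+t))
    (s≤s (+-mono-≤ x≤y (∸-monoˡ-≤ t x≤y)))

topDown-top-mono-≤ : ∀ n t {x y} → x ≤ y → y < n → topDown (n + t) n (1 , x) ≤ topDown (n + t) n (1 , y)
topDown-top-mono-≤ n t {x} {y} x≤y y<n =
  subst₂ _≤_ (sym (topDown-top n t x (≤-<-trans x≤y y<n))) (sym (topDown-top n t y y<n))
    (s≤s (s≤s (+-monoʳ-≤ t (+-mono-≤ x≤y x≤y))))

bottomLabel<topLabel : ∀ t {x y} → y ∸ t ≤ x → bottomLabel t y < topLabel t x
bottomLabel<topLabel zero    y≤x = s≤s (s≤s (+-mono-≤ y≤x y≤x))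
bottomLabel<topLabel (suc t) {y = zero}  _ = s≤s (s≤s z≤n)
bottomLabel<topLabel (suc t) {y = suc y} y∸t≤x = s≤s (bottomLabel<topLabel t y∸t≤x)

topLabel<bottomLabel : ∀ t {x y} → x < y ∸ t → topLabel t x < bottomLabel t y
topLabel<bottomLabel zero    {x} {suc y} (s≤s x≤y) =
  s≤s (s≤s (subst (suc (x + x) ≤_) (sym (+-suc y y)) (s≤s (+-mono-≤ x≤y x≤y))))
topLabel<bottomLabel (suc t) {y = suc y} x<y∸t = s≤s (topLabel<bottomLabel t x<y∸t)

bottomLabel<topLabel⁻¹ : ∀ t {x y} → bottomLabel t y < topLabel t x → y ∸ t ≤ x
bottomLabel<topLabel⁻¹ t lt = ≮⇒≥ (<-asym lt ∘ topLabel<bottomLabel t)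

topLabel<bottomLabel⁻¹ : ∀ t {x y} → topLabel t x < bottomLabel t y → x < y ∸ t
topLabel<bottomLabel⁻¹ t lt = ≰⇒> (<-asym lt ∘ bottomLabel<topLabel t)

∈-cells⁻ : ∀ {a b r c} → (r , c) ∈ cells (a , b) → (r ≡ 0 × c < a) ⊎ (r ≡ 1 × c < b)
∈-cells⁻ {a} {b} r,c∈ with ∈.∈-++⁻ (map (0 ,_) (upTo a)) r,c∈
... | inj₁ ∈bottom with ∈.∈-map⁻ (0 ,_) ∈bottom
...   | _ , c∈ , refl = inj₁ (refl , ∈.∈-upTo⁻ c∈)
∈-cells⁻ {a} {b} r,c∈ | inj₂ ∈top with ∈.∈-map⁻ (1 ,_) ∈top
...   | _ , c∈ , refl = inj₂ (refl , ∈.∈-upTo⁻ c∈)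

bottom∈cells : ∀ {a b c} → c < a → (0 , c) ∈ cells (a , b)
bottom∈cells c<a = ∈.∈-++⁺ˡ (∈.∈-map⁺ (0 ,_) (∈.∈-upTo⁺ c<a))

top∈cells : ∀ {a b c} → c < b → (1 , c) ∈ cells (a , b)
top∈cells {a} c<b = ∈.∈-++⁺ʳ (map (0 ,_) (upTo a)) (∈.∈-map⁺ (1 ,_) (∈.∈-upTo⁺ c<b))

bottom∉cells⇒≥ : ∀ {a b c} → (0 , c) ∉ cells (a , b) → a ≤ c
bottom∉cells⇒≥ c∉ = ≮⇒≥ (c∉ ∘ bottom∈cells)

top∉cells⇒≥ : ∀ {a b c} → (1 , c) ∉ cells (a , b) → b ≤ c
top∉cells⇒≥ c∉ = ≮⇒≥ (c∉ ∘ top∈cells)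

-- Deficit cells and sim

_⊑_ : ℕ × ℕ → ℕ × ℕ → Set
(a , b) ⊑ (m , n) = b ≤ a × a ≤ m × b ≤ n

DeficitColumn : ℕ → ℕ → ℕ → ℕ → Set
DeficitColumn t a b x = (a ∸ t ≤ x × x < b) ⊎ (b ≤ x × x < a ∸ suc t)

deficit⇒ : ∀ {n t a b r x} → (a , b) ⊑ (n + t , n) → Deficit (n + t , n) (a , b) (r , x) →
           r ≡ 0 × DeficitColumn t a b x
deficit⇒ {n} {t} {a} {b} (b≤a , a≤n+t , b≤n) D with find D
... | (_ , y₁) , c₁∈μ , D₂ with find D₂
... | (_ , y₂) , c₂∈λ , c₂∉μ , θc₂<θc₁ , refl with ∈-cells⁻ {a} {b} c₁∈μ | ∈-cells⁻ {n + t} {n} c₂∈λ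
... | inj₁ (refl , y₁<a) | inj₁ (refl , y₂<n+t) =
  contradiction θc₂<θc₁ (≤⇒≯ (topDown-bottom-mono-≤ n t (<⇒≤ (<-≤-trans y₁<a (bottom∉cells⇒≥ {a} {b} c₂∉μ))) y₂<n+t))
... | inj₂ (refl , y₁<b) | inj₂ (refl , y₂<n) =
  contradiction θc₂<θc₁ (≤⇒≯ (topDown-top-mono-≤ n t (<⇒≤ (<-≤-trans y₁<b (top∉cells⇒≥ {a} {b} c₂∉μ))) y₂<n))
... | inj₂ (refl , y₁<b) | inj₁ (refl , y₂<n+t) =
  refl , inj₁ (subst (a ∸ t ≤_) (sym y₁⊓y₂≡y₁) a∸t≤y₁ , subst (_< b) (sym y₁⊓y₂≡y₁) y₁<b)
  where
  a≤y₂ = bottom∉cells⇒≥ {a} {b} c₂∉μ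
  y₁⊓y₂≡y₁ = m≤n⇒m⊓n≡m (<⇒≤ (<-≤-trans y₁<b (≤-trans b≤a a≤y₂)))
  a∸t≤y₁ : a ∸ t ≤ y₁
  a∸t≤y₁ = ≤-trans (∸-monoˡ-≤ t a≤y₂) (bottomLabel<topLabel⁻¹ t
             (subst₂ _<_ (topDown-bottom n t y₂ y₂<n+t) (topDown-top n t y₁ (<-≤-trans y₁<b b≤n)) θc₂<θc₁))
... | inj₁ (refl , y₁<a) | inj₂ (refl , y₂<n) =
  refl , inj₂ (subst (b ≤_) (sym y₁⊓y₂≡y₂) (top∉cells⇒≥ {a} {b} c₂∉μ) ,
               subst (_< a ∸ suc t) (sym y₁⊓y₂≡y₂) y₂<a∸1+t)
  where
  y₂<y₁∸t : y₂ < y₁ ∸ t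
  y₂<y₁∸t = topLabel<bottomLabel⁻¹ t
              (subst₂ _<_ (topDown-top n t y₂ y₂<n) (topDown-bottom n t y₁ (<-≤-trans y₁<a a≤n+t)) θc₂<θc₁)
  y₁⊓y₂≡y₂ = m≥n⇒m⊓n≡n (<⇒≤ (<-≤-trans y₂<y₁∸t (m∸n≤m y₁ t)))
  y₂<a∸1+t : y₂ < a ∸ suc t
  y₂<a∸1+t = <-≤-trans y₂<y₁∸t (∸-monoˡ-≤ (suc t) y₁<a)

deficit⇐ : ∀ {n t a b x} → (a , b) ⊑ (n + t , n) → x < a → DeficitColumn t a b x →
           Deficit (n + t , n) (a , b) (0 , x)
deficit⇐ {n} {t} {a} {b} {x} (_ , _ , b≤n) x<a (inj₁ (a∸t≤x , x<b)) =
  lose (top∈cells x<b)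
       (lose (bottom∈cells {n + t} {n} a<n+t) (a∉μ , θa<θx , cong (0 ,_) (sym (m≤n⇒m⊓n≡m (<⇒≤ x<a)))))
  where
  a<n+t : a < n + t
  a<n+t = ≤-<-trans (m≤n+m∸n a t) (subst (t + (a ∸ t) <_) (+-comm t n)
            (+-monoʳ-< t (≤-<-trans a∸t≤x (<-≤-trans x<b b≤n))))
  a∉μ : (0 , a) ∉ cells (a , b)
  a∉μ a∈μ with ∈-cells⁻ {a} {b} a∈μ
  ... | inj₁ (_ , a<a) = <-irrefl refl a<a
  θa<θx : topDown (n + t) n (0 , a) < topDown (n + t) n (1 , x)
  θa<θx = subst₂ _<_ (sym (topDown-bottom n t a a<n+t)) (sym (topDown-top n t x (<-≤-trans x<b b≤n)))
            (bottomLabel<topLabel t a∸t≤x)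
deficit⇐ {n} {t} {suc a} {b} {x} (_ , 1+a≤n+t , _) x<1+a (inj₂ (b≤x , x<a∸t)) =
  lose (bottom∈cells {suc a} {b} ≤-refl)
       (lose (top∈cells {n + t} {n} x<n) (x∉μ , θx<θa , cong (0 ,_) (sym (m≥n⇒m⊓n≡n x≤a))))
  where
  x≤a = <⇒≤ (<-≤-trans x<a∸t (m∸n≤m a t))
  x<n : x < n
  x<n = <-≤-trans x<a∸t (≤-trans (∸-monoˡ-≤ t (n≤1+n a))
                                  (m≤n+o⇒m∸n≤o (suc a) t (subst (suc a ≤_) (+-comm n t) 1+a≤n+t)))
  x∉μ : (1 , x) ∉ cells (suc a , b)
  x∉μ x∈μ with ∈-cells⁻ {suc a} {b} x∈μ
  ... | inj₂ (_ , x<b) = <⇒≱ x<b b≤x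
  θx<θa : topDown (n + t) n (1 , x) < topDown (n + t) n (0 , a)
  θx<θa = subst₂ _<_ (sym (topDown-top n t x x<n)) (sym (topDown-bottom n t a 1+a≤n+t))
            (topLabel<bottomLabel t x<a∸t)

sim-outside : ∀ {n t a b p q} → (a , b) ⊑ (n + t , n) → p ≤ q →
              (∀ {x} → x < a → DeficitColumn t a b x ⇔ Inside p q x) →
              sim (n + t , n) (a , b) ≡ p ⊓ a + (a ∸ q) + b
sim-outside {n} {t} {a} {b} {p} {q} μ⊑λ p≤q column⇔inside = begin
  length (filter nonDeficit? (bottom ++ top))                          ≡⟨ cong length (filter-++ nonDeficit? bottom top) ⟩
  length (filter nonDeficit? bottom ++ filter nonDeficit? top)         ≡⟨ length-++ (filter nonDeficit? bottom) ⟩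
  length (filter nonDeficit? bottom) + length (filter nonDeficit? top) ≡⟨ cong₂ _+_ bottom-count top-count ⟩
  p ⊓ a + (a ∸ q) + b                                                  ∎
  where
  open ≡-Reasoning
  nonDeficit? : Decidable (¬_ ∘ Deficit (n + t , n) (a , b))
  nonDeficit? d = ¬? (deficit? (n + t , n) (a , b) d)
  bottom top : List Cell
  bottom = map (0 ,_) (upTo a)
  top    = map (1 ,_) (upTo b)
  deficit⇔inside : ∀ {x} → x < a → Deficit (n + t , n) (a , b) (0 , x) ⇔ Inside p q x
  deficit⇔inside x<a = mk⇔ (Equivalence.to (column⇔inside x<a) ∘ proj₂ ∘ deficit⇒ μ⊑λ)
                           (deficit⇐ μ⊑λ x<a ∘ Equivalence.from (column⇔inside x<a))
  bottom-count : length (filter nonDeficit? bottom) ≡ p ⊓ a + (a ∸ q)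
  bottom-count = trans (length-filter-map nonDeficit? (outside? p q) (0 ,_) (All.tabulate λ x∈ →
                   let e = deficit⇔inside (∈.∈-upTo⁻ x∈) in mk⇔ (_∘ Equivalence.from e) (_∘ Equivalence.to e)))
                       (count-outside p≤q a)
  top-count : length (filter nonDeficit? top) ≡ b
  top-count = begin
    length (filter nonDeficit? top) ≡⟨ cong length (filter-all nonDeficit? (All.tabulate no-deficit-on-top)) ⟩
    length top                      ≡⟨ length-map {A = ℕ} {B = Cell} (1 ,_) (upTo b) ⟩
    length (upTo b)                 ≡⟨ length-upTo b ⟩
    b                               ∎
    where
    no-deficit-on-top : ∀ {d} → d ∈ top → ¬ Deficit (n + t , n) (a , b) d
    no-deficit-on-top d∈top D with ∈.∈-map⁻ (1 ,_) d∈top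
    ... | _ , _ , refl with () ← proj₁ (deficit⇒ μ⊑λ D)

sim-right : ∀ {n t a b} → (a , b) ⊑ (n + t , n) → a ∸ t ≤ b → sim (n + t , n) (a , b) ≡ a + (a ∸ t)
sim-right {n} {t} {a} {b} μ⊑λ@(b≤a , _) a∸t≤b = begin
  sim (n + t , n) (a , b)          ≡⟨ sim-outside μ⊑λ a∸t≤b column⇔inside ⟩
  (a ∸ t) ⊓ a + (a ∸ b) + b        ≡⟨ cong (λ x → x + (a ∸ b) + b) (m≤n⇒m⊓n≡m (m∸n≤m a t)) ⟩
  (a ∸ t) + (a ∸ b) + b            ≡⟨ +-assoc (a ∸ t) (a ∸ b) b ⟩
  (a ∸ t) + (a ∸ b + b)            ≡⟨ cong ((a ∸ t) +_) (m∸n+n≡m b≤a) ⟩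
  (a ∸ t) + a                      ≡⟨ +-comm (a ∸ t) a ⟩
  a + (a ∸ t)                      ∎
  where
  open ≡-Reasoning
  column⇔inside : ∀ {x} → x < a → DeficitColumn t a b x ⇔ Inside (a ∸ t) b x
  column⇔inside _ = mk⇔ (λ { (inj₁ inside) → inside
                           ; (inj₂ (b≤x , x<a∸1+t)) → contradiction (≤-trans a∸t≤b b≤x)
                                                        (<⇒≱ (<-≤-trans x<a∸1+t (∸-monoʳ-≤ a (n≤1+n t)))) })
                        inj₁

sim-left : ∀ {n t a b} → (a , b) ⊑ (n + t , n) → b < a ∸ t → sim (n + t , n) (a , b) ≡ suc (t + 2 * b)
sim-left {n} {t} {a} {b} μ⊑λ@(b≤a , _) b<a∸t = begin
  sim (n + t , n) (a , b)          ≡⟨ sim-outside μ⊑λ b≤a∸1+t column⇔inside ⟩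
  b ⊓ a + (a ∸ (a ∸ suc t)) + b    ≡⟨ cong₂ (λ x y → x + y + b) (m≤n⇒m⊓n≡m b≤a) (m∸[m∸n]≡n t<a) ⟩
  b + suc t + b                    ≡⟨ solve 2 (λ b t → b :+ (con 1 :+ t) :+ b := con 1 :+ (t :+ con 2 :* b)) refl b t ⟩
  suc (t + 2 * b)                  ∎
  where
  open ≡-Reasoning
  open +-*-Solver
  b≤a∸1+t : b ≤ a ∸ suc t
  b≤a∸1+t = subst (b ≤_) (pred[m∸n]≡m∸[1+n] a t) (<⇒≤pred b<a∸t)
  t<a : suc t ≤ a
  t<a = m∸n≢0⇒n<m (λ a∸t≡0 → <⇒≢ (<-≤-trans z<s b<a∸t) (sym a∸t≡0))
  column⇔inside : ∀ {x} → x < a → DeficitColumn t a b x ⇔ Inside b (a ∸ suc t) x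
  column⇔inside _ = mk⇔ (λ { (inj₁ (a∸t≤x , x<b)) → contradiction (<-trans b<a∸t (≤-<-trans a∸t≤x x<b)) (<-irrefl refl)
                           ; (inj₂ inside) → inside })
                        inj₂

sim-cases : ∀ {n t a b} → (a , b) ⊑ (n + t , n) →
            (a ∸ t ≤ b × sim (n + t , n) (a , b) ≡ a + (a ∸ t)) ⊎
            (b < a ∸ t × sim (n + t , n) (a , b) ≡ suc (t + 2 * b))
sim-cases {t = t} {a} {b} μ⊑λ with a ∸ t ≤? b
... | yes a∸t≤b = inj₁ (a∸t≤b , sim-right μ⊑λ a∸t≤b)
... | no  a∸t≰b = inj₂ (≰⇒> a∸t≰b , sim-left μ⊑λ (≰⇒> a∸t≰b))

-- Subpartitions and the fibres E(s)

pairs≡cartesianProduct : ∀ (xs ys : List ℕ) → concatMap (λ a → map (a ,_) ys) xs ≡ cartesianProduct xs ys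
pairs≡cartesianProduct []       ys = refl
pairs≡cartesianProduct (x ∷ xs) ys = cong (map (x ,_) ys ++_) (pairs≡cartesianProduct xs ys)

private
  is-partition? : Decidable {A = ℕ × ℕ} (λ (a , b) → b ≤ a)
  is-partition? (a , b) = b ≤? a

  rectangle : ℕ × ℕ → List (ℕ × ℕ)
  rectangle (m , n) = cartesianProduct (upTo (suc m)) (upTo (suc n))

  subpartitions≡ : ∀ m n → subpartitions (m , n) ≡ filter is-partition? (rectangle (m , n))
  subpartitions≡ m n = cong (filter is-partition?) (pairs≡cartesianProduct (upTo (suc m)) (upTo (suc n)))

∈-subpartitions⁻ : ∀ {lam μ} → μ ∈ subpartitions lam → μ ⊑ lam
∈-subpartitions⁻ {m , n} {a , b} μ∈
  with ∈.∈-filter⁻ is-partition? {xs = rectangle (m , n)} (subst ((a , b) ∈_) (subpartitions≡ m n) μ∈)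
... | μ∈rectangle , b≤a with ∈.∈-cartesianProduct⁻ (upTo (suc m)) (upTo (suc n)) μ∈rectangle
... | a∈ , b∈ = b≤a , s≤s⁻¹ (∈.∈-upTo⁻ a∈) , s≤s⁻¹ (∈.∈-upTo⁻ b∈)

∈-subpartitions⁺ : ∀ {lam μ} → μ ⊑ lam → μ ∈ subpartitions lam
∈-subpartitions⁺ {m , n} {a , b} (b≤a , a≤m , b≤n) = subst ((a , b) ∈_) (sym (subpartitions≡ m n))
  (∈.∈-filter⁺ is-partition? (∈.∈-cartesianProduct⁺ (∈.∈-upTo⁺ (s≤s a≤m)) (∈.∈-upTo⁺ (s≤s b≤n))) b≤a)

subpartitions-unique : ∀ lam → Unique (subpartitions lam)
subpartitions-unique (m , n) = subst Unique (sym (subpartitions≡ m n))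
  (Unique.filter⁺ is-partition? (Unique.cartesianProduct⁺ (Unique.upTo⁺ (suc m)) (Unique.upTo⁺ (suc n))))

private
  sim≡? : ∀ lam s → Decidable (λ μ → sim lam μ ≡ s)
  sim≡? lam s μ = sim lam μ ≟ s

∈-E⁻ : ∀ {lam μ s} → μ ∈ E lam s → μ ⊑ lam × sim lam μ ≡ s
∈-E⁻ {lam} {s = s} μ∈ with ∈.∈-filter⁻ (sim≡? lam s) {xs = subpartitions lam} μ∈
... | μ∈subpartitions , sim≡s = ∈-subpartitions⁻ μ∈subpartitions , sim≡s

∈-E⁺ : ∀ {lam μ s} → μ ⊑ lam → sim lam μ ≡ s → μ ∈ E lam s
∈-E⁺ {lam} {s = s} μ⊑λ = ∈.∈-filter⁺ (sim≡? lam s) (∈-subpartitions⁺ μ⊑λ)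

E-unique : ∀ lam s → Unique (E lam s)
E-unique lam s = Unique.filter⁺ (sim≡? lam s) (subpartitions-unique lam)

module _ {m n i j : ℕ} (i≤m : i ≤ m) (j≤n : j ≤ n) where

  center-offsets : i ≡ j → Center (m , n) (m ∸ i , n ∸ j)
  center-offsets i≡j rewrite m∸[m∸n]≡n i≤m | m∸[m∸n]≡n j≤n = i≡j

  right-offsets : j < i → RightSide (m , n) (m ∸ i , n ∸ j)
  right-offsets j<i rewrite m∸[m∸n]≡n i≤m | m∸[m∸n]≡n j≤n = j<i

  left-offsets : i < j → LeftSide (m , n) (m ∸ i , n ∸ j)
  left-offsets i<j rewrite m∸[m∸n]≡n i≤m | m∸[m∸n]≡n j≤n = i<j

module SmallFibre {n t s : ℕ} (s≤t : s ≤ t) where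

  private
    to : ∀ {a b} → (a , b) ∈ E (n + t , n) s → ∃[ k ] (k ≤ s ⊓ n × (a , b) ≡ (s , k))
    to {a} {b} μ∈E with ∈-E⁻ μ∈E
    ... | μ⊑λ@(b≤a , _ , b≤n) , sim≡s with sim-cases μ⊑λ
    ... | inj₁ (_ , sim≡) = b , ⊓-glb (subst (b ≤_) a≡s b≤a) b≤n , cong (_, b) a≡s
      where
      a+[a∸t]≡s = trans (sym sim≡) sim≡s
      a≤t : a ≤ t
      a≤t = ≤-trans (m≤m+n a (a ∸ t)) (≤-trans (≤-reflexive a+[a∸t]≡s) s≤t)
      a≡s : a ≡ s
      a≡s = trans (sym (+-identityʳ a)) (trans (cong (a +_) (sym (m≤n⇒m∸n≡0 a≤t))) a+[a∸t]≡s)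
    ... | inj₂ (_ , sim≡) =
      contradiction (≤-trans (≤-reflexive (trans (sym sim≡) sim≡s)) s≤t) (<⇒≱ (s≤s (m≤m+n t (2 * b))))

    from : ∀ {k} → k ≤ s ⊓ n → (s , k) ∈ E (n + t , n) s
    from {k} k≤s⊓n = ∈-E⁺ μ⊑λ (trans (sim-right μ⊑λ s∸t≤k) (trans (cong (s +_) s∸t≡0) (+-identityʳ s)))
      where
      μ⊑λ = ≤-trans k≤s⊓n (m⊓n≤m s n) , ≤-trans s≤t (m≤n+m t n) , ≤-trans k≤s⊓n (m⊓n≤n s n)
      s∸t≡0 = m≤n⇒m∸n≡0 s≤t
      s∸t≤k = subst (_≤ k) (sym s∸t≡0) z≤n

  ∈E⇔ : ∀ μ → (μ ∈ E (n + t , n) s) ⇔ (∃[ k ] (k ≤ s ⊓ n × μ ≡ (s , k)))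
  ∈E⇔ μ = mk⇔ to λ { (k , k≤s⊓n , refl) → from k≤s⊓n }

  length-E : length (E (n + t , n) s) ≡ s ⊓ n + 1
  length-E = trans (length-enumeration (s ,_) (E-unique (n + t , n) s)
                      (λ μ∈E → let k , k≤s⊓n , μ≡ = to μ∈E in k , s≤s k≤s⊓n , μ≡)
                      (from ∘ s≤s⁻¹)
                      (λ i<j _ → <⇒≢ i<j ∘ cong proj₂))
                   (+-comm 1 (s ⊓ n))

  center∈E : s ≡ t → (t , 0) ∈ E (n + t , n) s
  center∈E refl = from z≤n

  center : Center (n + t , n) (t , 0)
  center = m+n∸n≡m n t

  ∈E⇒RightSide : ∀ {μ} → μ ∈ E (n + t , n) s → μ ≢ (t , 0) → RightSide (n + t , n) μ
  ∈E⇒RightSide μ∈E μ≢t,0 with to μ∈E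
  ... | zero , _ , refl = subst (n <_) (sym (+-∸-assoc n s≤t)) (m<m+n n (m<n⇒0<n∸m s<t))
    where s<t = ≤∧≢⇒< s≤t (μ≢t,0 ∘ cong (_, 0))
  ... | suc k , k<s⊓n , refl = subst (n ∸ suc k <_) (sym (+-∸-assoc n s≤t))
                                 (<-≤-trans (∸-monoʳ-< z<s (≤-trans k<s⊓n (m⊓n≤n s n))) (m≤m+n n (t ∸ s)))

module EvenFibre {n t s i : ℕ} (n≤1+t : n ≤ suc t) (t<s : t < s) (s+2i≡ : s + 2 * i ≡ n + t + n) where

  i<n : i < n
  i<n = ≰⇒> λ n≤i → <-irrefl (sym s+2i≡) (begin-strict
    n + t + n       <⟨ n<1+n _ ⟩
    suc (n + t + n) ≡⟨ solve 2 (λ n t → con 1 :+ (n :+ t :+ n) := con 1 :+ t :+ con 2 :* n) refl n t ⟩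
    suc t + 2 * n   ≤⟨ +-mono-≤ t<s (*-monoʳ-≤ 2 n≤i) ⟩
    s + 2 * i       ∎)
    where open ≤-Reasoning
          open +-*-Solver

  private
    i≤n = <⇒≤ i<n
    i≤n+t = ≤-trans i≤n (m≤m+n n t)

    n+t∸i≡[n∸i]+t : n + t ∸ i ≡ (n ∸ i) + t
    n+t∸i≡[n∸i]+t = +-∸-comm t i≤n

    s≡t+2[n∸i] : s ≡ t + 2 * (n ∸ i)
    s≡t+2[n∸i] = +-cancelʳ-≡ (2 * i) s (t + 2 * (n ∸ i)) (begin
      s + 2 * i                       ≡⟨ s+2i≡ ⟩
      n + t + n                       ≡⟨ cong (λ k → k + t + k) (m+[n∸m]≡n i≤n) ⟨
      i + (n ∸ i) + t + (i + (n ∸ i)) ≡⟨ solve 3 (λ i c t → i :+ c :+ t :+ (i :+ c) := t :+ con 2 :* c :+ con 2 :* i) refl i (n ∸ i) t ⟩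
      t + 2 * (n ∸ i) + 2 * i         ∎)
      where open ≡-Reasoning
            open +-*-Solver

    to : ∀ {a b} → (a , b) ∈ E (n + t , n) s → ∃[ j ] (j ≤ i × (a , b) ≡ (n + t ∸ i , n ∸ j))
    to {a} {b} μ∈E with ∈-E⁻ μ∈E
    ... | μ⊑λ@(_ , _ , b≤n) , sim≡s with sim-cases μ⊑λ
    ... | inj₁ (a∸t≤b , sim≡) = n ∸ b , n∸b≤i , cong₂ _,_ a≡n+t∸i (sym (m∸[m∸n]≡n b≤n))
      where
      a+[a∸t]≡s = trans (sym sim≡) sim≡s
      t≤a = n<m+[m∸n]⇒n≤m (subst (t <_) (sym a+[a∸t]≡s) t<s)
      a∸t≡n∸i : a ∸ t ≡ n ∸ i
      a∸t≡n∸i = t+2u≡t+2c⇒u≡c t (trans (sym (m+[m∸n]≡n+2[m∸n] t≤a)) (trans a+[a∸t]≡s s≡t+2[n∸i]))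
      a≡n+t∸i : a ≡ n + t ∸ i
      a≡n+t∸i = trans (sym (m∸n+n≡m t≤a)) (trans (cong (_+ t) a∸t≡n∸i) (sym n+t∸i≡[n∸i]+t))
      n∸b≤i : n ∸ b ≤ i
      n∸b≤i = subst (n ∸ b ≤_) (m∸[m∸n]≡n i≤n) (∸-monoʳ-≤ n (subst (_≤ b) a∸t≡n∸i a∸t≤b))
    ... | inj₂ (_ , sim≡) =
      contradiction (trans (sym s≡t+2[n∸i]) (trans (sym sim≡s) sim≡)) (t+2u≢1+t+2c t (n ∸ i) b)

    from : ∀ {j} → j ≤ i → (n + t ∸ i , n ∸ j) ∈ E (n + t , n) s
    from {j} j≤i = ∈-E⁺ μ⊑λ (begin
      sim (n + t , n) (a , n ∸ j) ≡⟨ sim-right μ⊑λ a∸t≤n∸j ⟩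
      a + (a ∸ t)                 ≡⟨ m+[m∸n]≡n+2[m∸n] t≤a ⟩
      t + 2 * (a ∸ t)             ≡⟨ cong (λ u → t + 2 * u) a∸t≡n∸i ⟩
      t + 2 * (n ∸ i)             ≡⟨ s≡t+2[n∸i] ⟨
      s                           ∎)
      where
      open ≡-Reasoning
      a = n + t ∸ i
      a∸t≡n∸i : a ∸ t ≡ n ∸ i
      a∸t≡n∸i = trans (cong (_∸ t) n+t∸i≡[n∸i]+t) (m+n∸n≡m (n ∸ i) t)
      t≤a : t ≤ a
      t≤a = subst (t ≤_) (sym n+t∸i≡[n∸i]+t) (m≤n+m t (n ∸ i))
      a∸t≤n∸j : a ∸ t ≤ n ∸ j
      a∸t≤n∸j = subst (_≤ n ∸ j) (sym a∸t≡n∸i) (∸-monoʳ-≤ n j≤i)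
      n≤a : n ≤ a
      n≤a = subst (_≤ a) (m∸n+n≡m i≤n)
              (subst (n ∸ i + i ≤_) (sym n+t∸i≡[n∸i]+t) (+-monoʳ-≤ (n ∸ i) (s≤s⁻¹ (<-≤-trans i<n n≤1+t))))
      μ⊑λ = ≤-trans (m∸n≤m n j) n≤a , m∸n≤m (n + t) i , m∸n≤m n j

  ∈E⇔ : ∀ μ → (μ ∈ E (n + t , n) s) ⇔ (∃[ j ] (j ≤ i × μ ≡ (n + t ∸ i , n ∸ j)))
  ∈E⇔ μ = mk⇔ to λ { (j , j≤i , refl) → from j≤i }

  length-E : length (E (n + t , n) s) ≡ i + 1
  length-E = trans (length-enumeration (λ j → (n + t ∸ i , n ∸ j)) (E-unique (n + t , n) s)
                      (λ μ∈E → let j , j≤i , μ≡ = to μ∈E in j , s≤s j≤i , μ≡)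
                      (from ∘ s≤s⁻¹)
                      (λ j<j′ j′<1+i → <⇒≢ (∸-monoʳ-< j<j′ (≤-trans (s≤s⁻¹ j′<1+i) i≤n)) ∘ sym ∘ cong proj₂))
                   (+-comm 1 i)

  center∈E : (n + t ∸ i , n ∸ i) ∈ E (n + t , n) s
  center∈E = from ≤-refl

  center : Center (n + t , n) (n + t ∸ i , n ∸ i)
  center = center-offsets i≤n+t i≤n refl

  ∈E⇒RightSide : ∀ {μ} → μ ∈ E (n + t , n) s → μ ≢ (n + t ∸ i , n ∸ i) → RightSide (n + t , n) μ
  ∈E⇒RightSide μ∈E μ≢center with to μ∈E
  ... | j , j≤i , refl =
    right-offsets i≤n+t (≤-trans j≤i i≤n) (≤∧≢⇒< j≤i (μ≢center ∘ cong (λ k → (n + t ∸ i , n ∸ k))))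

module OddFibre {n t s j : ℕ} (t<s : t < s) (s≤n+t+n : s ≤ n + t + n) (s+2j≡ : s + 2 * j ≡ n + t + n + 1) where

  1≤j : 1 ≤ j
  1≤j = n≢0⇒n>0 λ j≡0 → <⇒≱ (m<m+n (n + t + n) z<s)
    (subst (_≤ n + t + n) (trans (sym (trans (cong (λ k → s + 2 * k) j≡0) (+-identityʳ s))) s+2j≡) s≤n+t+n)

  j≤n : j ≤ n
  j≤n = ≮⇒≥ λ n<j → <-irrefl (sym s+2j≡) (begin-strict
    n + t + n + 1             <⟨ n<1+n _ ⟩
    suc (n + t + n + 1)       <⟨ n<1+n _ ⟩
    suc (suc (n + t + n + 1)) ≡⟨ solve 2 (λ n t → con 2 :+ (n :+ t :+ n :+ con 1) := con 1 :+ t :+ con 2 :* (con 1 :+ n)) refl n t ⟩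
    suc t + 2 * suc n         ≤⟨ +-mono-≤ t<s (*-monoʳ-≤ 2 n<j) ⟩
    s + 2 * j                 ∎)
    where open ≤-Reasoning
          open +-*-Solver

  private
    j≤n+t = ≤-trans j≤n (m≤m+n n t)

    s≡1+t+2[n∸j] : s ≡ suc (t + 2 * (n ∸ j))
    s≡1+t+2[n∸j] = +-cancelʳ-≡ (2 * j) s (suc (t + 2 * (n ∸ j))) (begin
      s + 2 * j                           ≡⟨ s+2j≡ ⟩
      n + t + n + 1                       ≡⟨ cong (λ k → k + t + k + 1) (m+[n∸m]≡n j≤n) ⟨
      j + (n ∸ j) + t + (j + (n ∸ j)) + 1 ≡⟨ solve 3 (λ j c t → j :+ c :+ t :+ (j :+ c) :+ con 1 := con 1 :+ (t :+ con 2 :* c) :+ con 2 :* j) refl j (n ∸ j) t ⟩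
      suc (t + 2 * (n ∸ j)) + 2 * j       ∎)
      where open ≡-Reasoning
            open +-*-Solver

    to : ∀ {a b} → (a , b) ∈ E (n + t , n) s → ∃[ i ] (i < j × (a , b) ≡ (n + t ∸ i , n ∸ j))
    to {a} {b} μ∈E with ∈-E⁻ μ∈E
    ... | μ⊑λ@(_ , a≤n+t , _) , sim≡s with sim-cases μ⊑λ
    ... | inj₁ (_ , sim≡) =
      contradiction (trans (sym (m+[m∸n]≡n+2[m∸n] t≤a)) (trans a+[a∸t]≡s s≡1+t+2[n∸j])) (t+2u≢1+t+2c t (a ∸ t) (n ∸ j))
      where
      a+[a∸t]≡s = trans (sym sim≡) sim≡s
      t≤a = n<m+[m∸n]⇒n≤m (subst (t <_) (sym a+[a∸t]≡s) t<s)
    ... | inj₂ (b<a∸t , sim≡) = n + t ∸ a , n+t∸a<j , cong₂ _,_ (sym (m∸[m∸n]≡n a≤n+t)) b≡n∸j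
      where
      b≡n∸j : b ≡ n ∸ j
      b≡n∸j = t+2u≡t+2c⇒u≡c t (suc-injective (trans (sym sim≡) (trans sim≡s s≡1+t+2[n∸j])))
      t≤a : t ≤ a
      t≤a = <⇒≤ (m∸n≢0⇒n<m (λ a∸t≡0 → <⇒≢ (<-≤-trans z<s b<a∸t) (sym a∸t≡0)))
      n+t<a+j : n + t < a + j
      n+t<a+j = begin-strict
        n + t             ≡⟨ cong (_+ t) (m∸n+n≡m j≤n) ⟨
        n ∸ j + j + t     ≡⟨ solve 3 (λ c j t → c :+ j :+ t := c :+ t :+ j) refl (n ∸ j) j t ⟩
        n ∸ j + t + j     ≡⟨ cong (λ k → k + t + j) b≡n∸j ⟨
        b + t + j         <⟨ +-monoˡ-< j (m≤o∸n⇒m+n≤o (suc b) t≤a b<a∸t) ⟩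
        a + j             ∎
        where open ≤-Reasoning
              open +-*-Solver
      n+t∸a<j : n + t ∸ a < j
      n+t∸a<j = m<n+o⇒m∸n<o (n + t) a {{>-nonZero 1≤j}} n+t<a+j

    from : ∀ {i} → i < j → (n + t ∸ i , n ∸ j) ∈ E (n + t , n) s
    from {i} i<j = ∈-E⁺ μ⊑λ (trans (sim-left μ⊑λ n∸j<a∸t) (sym s≡1+t+2[n∸j]))
      where
      i≤n = <⇒≤ (<-≤-trans i<j j≤n)
      a = n + t ∸ i
      a∸t≡n∸i : a ∸ t ≡ n ∸ i
      a∸t≡n∸i = trans (cong (_∸ t) (+-∸-comm t i≤n)) (m+n∸n≡m (n ∸ i) t)
      n∸j<n∸i : n ∸ j < n ∸ i
      n∸j<n∸i = ∸-monoʳ-< i<j j≤n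
      n∸j<a∸t : n ∸ j < a ∸ t
      n∸j<a∸t = subst (n ∸ j <_) (sym a∸t≡n∸i) n∸j<n∸i
      μ⊑λ = ≤-trans (<⇒≤ n∸j<a∸t) (m∸n≤m a t) , m∸n≤m (n + t) i , m∸n≤m n j

  ∈E⇔ : ∀ μ → (μ ∈ E (n + t , n) s) ⇔ (∃[ i ] (i < j × μ ≡ (n + t ∸ i , n ∸ j)))
  ∈E⇔ μ = mk⇔ to λ { (i , i<j , refl) → from i<j }

  length-E : length (E (n + t , n) s) ≡ j
  length-E = length-enumeration (λ i → (n + t ∸ i , n ∸ j)) (E-unique (n + t , n) s) to from
               (λ i<i′ i′<j → <⇒≢ (∸-monoʳ-< i<i′ (≤-trans (<⇒≤ i′<j) j≤n+t)) ∘ sym ∘ cong proj₁)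

  ∈E⇒LeftSide : ∀ {μ} → μ ∈ E (n + t , n) s → LeftSide (n + t , n) μ
  ∈E⇒LeftSide μ∈E with to μ∈E
  ... | i , i<j , refl = left-offsets (≤-trans (<⇒≤ i<j) j≤n+t) j≤n i<j

proposition5p19 : (m n : ℕ) → Triangular m n → (s : ℕ) → s ≤ m + n →
  -- (1)
  (s ≤ m ∸ n →
    (∀ μ → (μ ∈ E (m , n) s) ⇔ (∃[ k ] (k ≤ s ⊓ n × μ ≡ (s , k)))) ×
    length (E (m , n) s) ≡ s ⊓ n + 1 ×
    (∀ μ → μ ∈ E (m , n) s →
      (μ ≡ (m ∸ n , 0) → Center (m , n) μ) × (μ ≢ (m ∸ n , 0) → RightSide (m , n) μ)) ×
    (s ≡ m ∸ n → (m ∸ n , 0) ∈ E (m , n) s)) ×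
  -- (2)
  (m ∸ n < s → s % 2 ≡ (m + n) % 2 →
    ∃[ i ] (i < n × s + 2 * i ≡ m + n ×
      (∀ μ → (μ ∈ E (m , n) s) ⇔ (∃[ j ] (j ≤ i × μ ≡ (m ∸ i , n ∸ j)))) ×
      length (E (m , n) s) ≡ i + 1 ×
      (m ∸ i , n ∸ i) ∈ E (m , n) s ×
      Center (m , n) (m ∸ i , n ∸ i) ×
      (∀ μ → μ ∈ E (m , n) s → μ ≢ (m ∸ i , n ∸ i) → RightSide (m , n) μ))) ×
  -- (3)
  (m ∸ n < s → ¬ (s % 2 ≡ (m + n) % 2) →
    ∃[ j ] (1 ≤ j × j ≤ n × s + 2 * j ≡ m + n + 1 ×
      (∀ μ → (μ ∈ E (m , n) s) ⇔ (∃[ i ] (i < j × μ ≡ (m ∸ i , n ∸ j)))) ×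
      length (E (m , n) s) ≡ j ×
      (∀ μ → μ ∈ E (m , n) s → LeftSide (m , n) μ)))
proposition5p19 m n triangular s s≤m+n
  with t , refl ← m≤n⇒∃[o]m+o≡n (proj₁ triangular) rewrite m+n∸m≡n n t =
    (λ s≤t → let open SmallFibre {n} s≤t in
      ∈E⇔ , length-E , (λ _ μ∈E → (λ { refl → center }) , ∈E⇒RightSide μ∈E) , center∈E)
  , (λ t<s same-parity → let i , s+2i≡ = same-parity⇒even-gap s≤m+n same-parity
                             open EvenFibre {i = i} n≤1+t t<s s+2i≡ in
      i , i<n , s+2i≡ , ∈E⇔ , length-E , center∈E , center , λ _ → ∈E⇒RightSide)
  , (λ t<s different-parity → let j , s+2j≡ = different-parity⇒odd-gap s≤m+n different-parity
                                  open OddFibre {n} {j = j} t<s s≤m+n s+2j≡ in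
      j , 1≤j , j≤n , s+2j≡ , ∈E⇔ , length-E , λ _ → ∈E⇒LeftSide)
  where
  n≤1+t : n ≤ suc t
  n≤1+t = +-cancelˡ-≤ n n (suc t) (subst (n + n ≤_) (sym (+-suc n t)) (triangular⇒n+n≤1+m triangular))
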